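{- Let $n\ge1$. There is a well-defined group morphism $\varphi:\mathbb{Z}/2\mathbb{Z}*\mathrm{Sym}(n+1)\to(\mathbb{Z}/2\mathbb{Z})^{n+1}\rtimes_Q\mathrm{Sym}(n+1)$ given, for all $s_1,\dots,s_l\in\mathbb{Z}/2\mathbb{Z}$ and $\sigma_1,\dots,\sigma_l\in\mathrm{Sym}(n+1)$, by $$\varphi(s_1\sigma_1s_2\sigma_2\cdots s_l\sigma_l)=\Big(\sum_{i=1}^{l}Q(\sigma_1\cdots\sigma_{i-1})\,(s_i\mathbf{1}),\ \sigma_1\cdots\sigma_l\Big),$$ where $\mathbf{1}=(1,\dots,1)$ and the empty product of permutations is $\mathrm{id}$.
   Context: $\mathrm{Sym}(n+1)$ is the group of bijections of $\{1,\dots,n+1\}$ with product $\sigma\cdot\rho:=\rho\circ\sigma$; $(n+1\ n+1)=\mathrm{id}$. $\mathbb{Z}/2\mathbb{Z}*\mathrm{Sym}(n+1)$ is the free product of groups; every element is a product $s_1\sigma_1\cdots s_l\sigma_l$ with $s_i\in\mathbb{Z}/2\mathbb{Z}$, $\sigma_i\in\mathrm{Sym}(n+1)$ (not uniquely). Arithmetic in $\mathbb{Z}/2\mathbb{Z}$; $\delta_{i,j}$ Kronecker delta; vectors are columns. $Q(\sigma)$ is the matrix $Q(\sigma)_{i,j}=\delta_{(n+1\ \sigma(n+1))(\sigma(i)),\,j}+\delta_{\sigma(n+1),j}(1+\delta_{n+1,\sigma(i)})(1+\delta_{\sigma(n+1),n+1})$, and $\sigma\mapsto Q(\sigma)$ is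 a morphism into $\mathrm{GL}((\mathbb{Z}/2\mathbb{Z})^{n+1})$. The semidirect product $(\mathbb{Z}/2\mathbb{Z})^{n+1}\rtimes_Q\mathrm{Sym}(n+1)$ has product $(b,\sigma)(b',\sigma')=(b+Q(\sigma)b',\sigma\cdot\sigma')$. -}

module Defs where

open import Data.Nat using (ℕ; zero; suc)
open import Data.Bool using (Bool; true; false; _xor_; _∧_; not; if_then_else_)
open import Data.Fin using (Fin; fromℕ; _≟_)
open import Data.Fin.Permutation using (Permutation′; _⟨$⟩ʳ_; _∘ₚ_; id; transpose)
open import Data.Vec using (Vec; tabulate; lookup; replicate; foldr; allFin; zipWith; map)
open import Data.List using (List; []; _∷_; _++_; concatMap)
open import Data.Product using (_×_; _,_; proj₁; proj₂)
open import Data.Sum using (_⊎_; inj₁; inj₂)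
open import Relation.Nullary.Decidable using (⌊_⌋)
open import Relation.Binary.PropositionalEquality using (_≡_)

-- Z/2Z is Bool with xor as addition (false = 0, true = 1).

-- Sym(n+1): permutations of Fin (suc n); the paper's product σ·ρ := ρ ∘ σ
-- is  σ ∘ₚ ρ  (apply σ first).
Sym : ℕ → Set
Sym n = Permutation′ (suc n)

_·_ : ∀ {n} → Sym n → Sym n → Sym n
σ · ρ = σ ∘ₚ ρ

_≈ₚ_ : ∀ {n} → Sym n → Sym n → Set
σ ≈ₚ ρ = ∀ i → σ ⟨$⟩ʳ i ≡ ρ ⟨$⟩ʳ i

δ : ∀ {m} → Fin m → Fin m → Bool
δ i j = ⌊ i ≟ j ⌋

-- the element n+1 of {1,…,n+1}
top : ∀ n → Fin (suc n)
top n = fromℕ n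

Qentry : ∀ n → Sym n → Fin (suc n) → Fin (suc n) → Bool
Qentry n σ i j =
  δ (transpose (top n) (σ ⟨$⟩ʳ top n) ⟨$⟩ʳ (σ ⟨$⟩ʳ i)) j
  xor (δ (σ ⟨$⟩ʳ top n) j ∧ (not (δ (top n) (σ ⟨$⟩ʳ i)) ∧ not (δ (σ ⟨$⟩ʳ top n) (top n))))

V : ℕ → Set
V n = Vec Bool (suc n)

_⊕_ : ∀ {n} → V n → V n → V n
_⊕_ = zipWith _xor_

zeroV : ∀ n → V n
zeroV n = replicate (suc n) false

scal1 : ∀ n → Bool → V n
scal1 n s = replicate (suc n) s

Qapp : ∀ n → Sym n → V n → V n
Qapp n σ b = tabulate λ i → foldr (λ _ → Bool) _xor_ false
  (map (λ j → Qentry n σ i j ∧ lookup b j) (allFin (suc n)))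

SD : ℕ → Set
SD n = V n × Sym n

_∙SD_ : ∀ {n} → SD n → SD n → SD n
_∙SD_ {n} (b , σ) (b' , σ') = (b ⊕ Qapp n σ b') , (σ · σ')

_≈SD_ : ∀ {n} → SD n → SD n → Set
(b , σ) ≈SD (b' , σ') = (b ≡ b') × (σ ≈ₚ σ')

-- The free product Z/2Z * Sym(n+1), by its standard presentation:
-- words in the letters Z/2Z ⊎ Sym(n+1), modulo the congruence generated
-- by the multiplication tables of the two factors and their identities.

Letter : ℕ → Set
Letter n = Bool ⊎ Sym n

Word : ℕ → Set
Word n = List (Letter n)

data Rel {n : ℕ} : Word n → Word n → Set where
  z2-mul  : ∀ s t → Rel (inj₁ s ∷ inj₁ t ∷ []) (inj₁ (s xor t) ∷ [])
  z2-unit : Rel (inj₁ false ∷ []) []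
  sym-mul : ∀ σ ρ τ → τ ≈ₚ (σ · ρ) → Rel (inj₂ σ ∷ inj₂ ρ ∷ []) (inj₂ τ ∷ [])
  sym-unit : ∀ τ → τ ≈ₚ id → Rel (inj₂ τ ∷ []) []

data _~_ {n : ℕ} : Word n → Word n → Set where
  step  : ∀ l u v r → Rel u v → (l ++ u ++ r) ~ (l ++ v ++ r)
  ~refl : ∀ {u} → u ~ u
  ~sym  : ∀ {u v} → u ~ v → v ~ u
  ~trans : ∀ {u v w} → u ~ v → v ~ w → u ~ w

embed : ∀ {n} → List (Bool × Sym n) → Word n
embed = concatMap (λ p → inj₁ (proj₁ p) ∷ inj₂ (proj₂ p) ∷ [])

-- the paper's formula:  ( Σ_{i=1}^l Q(σ₁⋯σ_{i-1}) (s_i 1) , σ₁⋯σ_l ),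
-- computed with an accumulated prefix product π = σ₁⋯σ_{i-1}.
formulaFrom : ∀ n → Sym n → List (Bool × Sym n) → SD n
formulaFrom n π [] = zeroV n , π
formulaFrom n π ((s , σ) ∷ w) =
  (Qapp n π (scal1 n s) ⊕ proj₁ (formulaFrom n (π · σ) w)) , proj₂ (formulaFrom n (π · σ) w)

formula : ∀ n → List (Bool × Sym n) → SD n
formula n w = formulaFrom n id w

{-# OPTIONS --safe #-}
-- Let S = shear (top n) be the involution of (Z/2Z)^{n+1} adding the last
-- coordinate to all the others, and P_σ the permutation matrix with
-- (P_σ b)_k = b_{σ(k)}.  A short case analysis on the transposition in the
-- definition of Q gives Q(σ) = S P_σ S, so σ ↦ Q(σ) is a morphism and the
-- semidirect product is a monoid.  The map sending s to (s𝟏, id) and σ to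
-- (0, σ) is a morphism on each free factor, so its multiplicative extension to
-- words respects the relations presenting the free product; on s₁σ₁⋯s_lσ_l it
-- unfolds, by induction on l, to the stated sum.
module Submission where

open import Algebra.Bundles using (Monoid; CommutativeRing)
open import Algebra.Definitions using (Congruent₂; Associative; LeftIdentity; RightIdentity)
open import Data.Bool using (Bool; true; false; _xor_; _∧_; not)
open import Data.Bool.Properties
  using (xor-assoc; xor-comm; xor-same; xor-identityˡ; xor-identityʳ; ∧-assoc; ∧-zeroʳ;
         ∧-distribˡ-xor; ∧-distribʳ-xor; xor-∧-commutativeRing)
open import Data.Fin using (Fin; zero; suc; _≟_)
import Data.Fin.Permutation.Components as PC
open import Data.Fin.Permutation using (_⟨$⟩ʳ_; id)
import Data.Fin.Properties as Fin
open import Data.List using (List; []; _∷_; _++_)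
open import Data.List.Effectful.Foldable using (foldMap; ++-homo)
open import Data.Nat using (ℕ; _≤_; zero; suc)
open import Data.Product using (Σ; _×_; _,_; proj₁; proj₂)
open import Data.Sum using (inj₁; inj₂)
open import Data.Vec using (lookup; tabulate; foldr; map; allFin)
open import Data.Vec.Properties
  using (lookup∘tabulate; tabulate-allFin; lookup-zipWith; lookup-replicate;
         zipWith-assoc; zipWith-identityˡ; zipWith-identityʳ; zipWith-replicate)
open import Data.Vec.Relation.Binary.Pointwise.Extensional using (ext; Pointwise-≡⇒≡)
open import Function using (_∘_; Injective)
open import Function.Bundles using (Injection)
open import Function.Properties.Inverse using (↔⇒↣)
open import Level using (0ℓ)
open import Relation.Binary.PropositionalEquality
  using (_≡_; _≢_; _≗_; refl; sym; trans; cong; cong₂; module ≡-Reasoning)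
import Relation.Binary.Reasoning.Setoid as SetoidReasoning
open import Relation.Binary.Structures using (IsEquivalence)
open import Relation.Nullary using (yes; no)
open import Relation.Nullary.Decidable using (dec-true; dec-false; isYes≗does; ⌊⌋-map′)

open import Defs

open import Algebra.Properties.Semiring.Sum (CommutativeRing.semiring xor-∧-commutativeRing)
  using (sum; sum-cong-≗; ∑-distrib-+; sum-replicate-zero)
open import Algebra.Properties.CommutativeSemigroup
  (CommutativeRing.+-commutativeSemigroup xor-∧-commutativeRing)
  using (interchange)

δ-refl : ∀ {m} (a : Fin m) → δ a a ≡ true
δ-refl a = trans (isYes≗does (a ≟ a)) (dec-true (a ≟ a) refl)

δ-≢ : ∀ {m} {a b : Fin m} → a ≢ b → δ a b ≡ false
δ-≢ {a = a} {b} a≢b = trans (isYes≗does (a ≟ b)) (dec-false (a ≟ b) a≢b)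

δ-suc : ∀ {m} (a b : Fin m) → δ (suc a) (suc b) ≡ δ a b
δ-suc a b = ⌊⌋-map′ (cong suc) Fin.suc-injective (a ≟ b)

δ-injective : ∀ {m k} {f : Fin m → Fin k} → Injective _≡_ _≡_ f → ∀ a b → δ (f a) (f b) ≡ δ a b
δ-injective {f = f} f-inj a b with a ≟ b
... | yes refl = δ-refl (f a)
... | no a≢b  = δ-≢ (a≢b ∘ f-inj)

xor-cancelʳ : ∀ a b → (a xor b) xor b ≡ a
xor-cancelʳ a b = trans (xor-assoc a b b) (trans (cong (a xor_) (xor-same b)) (xor-identityʳ a))

xor-cancel-common : ∀ a b c → (a xor b) xor (c xor b) ≡ a xor c
xor-cancel-common a b c =
  trans (interchange a b c b) (trans (cong ((a xor c) xor_) (xor-same b)) (xor-identityʳ (a xor c)))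

foldr-xor-tabulate : ∀ {m} (f : Fin m → Bool) → foldr (λ _ → Bool) _xor_ false (tabulate f) ≡ sum f
foldr-xor-tabulate {zero}  f = refl
foldr-xor-tabulate {suc m} f = cong (f zero xor_) (foldr-xor-tabulate (f ∘ suc))

sum-δ : ∀ {m} (a : Fin m) (f : Fin m → Bool) → sum (λ j → δ a j ∧ f j) ≡ f a
sum-δ {suc m} zero    f = trans (cong (f zero xor_) (sum-replicate-zero m)) (xor-identityʳ (f zero))
sum-δ {suc m} (suc a) f = trans (sum-cong-≗ (λ j → cong (_∧ f (suc j)) (δ-suc a j))) (sum-δ a (f ∘ suc))

sum-δ-row : ∀ {m} (a c : Fin m) (e : Bool) (f : Fin m → Bool) →
            sum (λ j → (δ a j xor (δ c j ∧ e)) ∧ f j) ≡ f a xor (e ∧ f c)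
sum-δ-row a c e f = begin
  sum (λ j → (δ a j xor (δ c j ∧ e)) ∧ f j)
    ≡⟨ sum-cong-≗ (λ j → trans (∧-distribʳ-xor (f j) (δ a j) (δ c j ∧ e))
                               (cong ((δ a j ∧ f j) xor_) (∧-assoc (δ c j) e (f j)))) ⟩
  sum (λ j → (δ a j ∧ f j) xor (δ c j ∧ (e ∧ f j)))
    ≡⟨ ∑-distrib-+ (λ j → δ a j ∧ f j) (λ j → δ c j ∧ (e ∧ f j)) ⟩
  sum (λ j → δ a j ∧ f j) xor sum (λ j → δ c j ∧ (e ∧ f j))
    ≡⟨ cong₂ _xor_ (sum-δ a f) (sum-δ c (λ j → e ∧ f j)) ⟩
  f a xor (e ∧ f c) ∎
  where open ≡-Reasoning

shear : ∀ {m} → Fin m → (Fin m → Bool) → Fin m → Bool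
shear t f k = f k xor (not (δ t k) ∧ f t)

module _ {m} (t : Fin m) where

  shear-self : ∀ f → shear t f t ≡ f t
  shear-self f = trans (cong (λ d → f t xor (not d ∧ f t)) (δ-refl t)) (xor-identityʳ (f t))

  shear-cong : ∀ {f g} → f ≗ g → shear t f ≗ shear t g
  shear-cong f≗g k = cong₂ (λ a b → a xor (not (δ t k) ∧ b)) (f≗g k) (f≗g t)

  shear-xor : ∀ f g → shear t (λ k → f k xor g k) ≗ λ k → shear t f k xor shear t g k
  shear-xor f g k = trans (cong ((f k xor g k) xor_) (∧-distribˡ-xor (not (δ t k)) (f t) (g t)))
                          (interchange (f k) (g k) _ _)

  shear-false : shear t (λ _ → false) ≗ λ _ → false
  shear-false k = ∧-zeroʳ (not (δ t k))

  shear-involutive : ∀ f → shear t (shear t f) ≗ f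
  shear-involutive f k = trans (cong (λ b → shear t f k xor (not (δ t k) ∧ b)) (shear-self f))
                               (xor-cancelʳ (f k) _)

transposition-row : ∀ {m} (t c x : Fin m) (f : Fin m → Bool) →
  f (PC.transpose t c x) xor ((not (δ t x) ∧ not (δ c t)) ∧ f c)
    ≡ shear t f x xor (not (δ c x) ∧ shear t f c)
-- The splits on x ≟ t and x ≟ c are those of PC.transpose t c x, which therefore
-- computes in every branch.
transposition-row t c x f with x ≟ t
... | yes refl rewrite δ-refl x with c ≟ x
...   | yes refl = sym (xor-identityʳ (f x xor false))
...   | no c≢x rewrite δ-≢ (c≢x ∘ sym) | xor-identityʳ (f c) | xor-identityʳ (f x) =
  sym (xor-cancel-common false (f x) (f c))
transposition-row t c x f | no x≢t with x ≟ c
...   | yes refl rewrite δ-≢ x≢t | δ-≢ (x≢t ∘ sym) | δ-refl x | xor-identityʳ (f x xor f t) =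
  xor-comm (f t) (f x)
...   | no x≢c rewrite δ-≢ (x≢t ∘ sym) | δ-≢ (x≢c ∘ sym) with c ≟ t
...     | yes refl rewrite δ-refl c | xor-identityʳ (f x) | xor-identityʳ (f c) =
  sym (xor-cancelʳ (f x) (f c))
...     | no c≢t rewrite δ-≢ (c≢t ∘ sym) = sym (xor-cancel-common (f x) (f t) (f c))

lookup-Qapp : ∀ n (σ : Sym n) (v : V n) →
              lookup (Qapp n σ v) ≗ shear (top n) (shear (top n) (lookup v) ∘ (σ ⟨$⟩ʳ_))
lookup-Qapp n σ v i = begin
  lookup (Qapp n σ v) i
    ≡⟨ lookup∘tabulate (λ i → foldr (λ _ → Bool) _xor_ false
                                (map (λ j → Qentry n σ i j ∧ lookup v j) (allFin (suc n)))) i ⟩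
  foldr (λ _ → Bool) _xor_ false (map row (allFin (suc n)))
    ≡⟨ cong (foldr (λ _ → Bool) _xor_ false) (tabulate-allFin row) ⟨
  foldr (λ _ → Bool) _xor_ false (tabulate row)
    ≡⟨ foldr-xor-tabulate row ⟩
  sum row
    ≡⟨ sum-δ-row (PC.transpose t c x) c e (lookup v) ⟩
  lookup v (PC.transpose t c x) xor (e ∧ lookup v c)
    ≡⟨ transposition-row t c x (lookup v) ⟩
  shear t (lookup v) x xor (not (δ c x) ∧ shear t (lookup v) c)
    ≡⟨ cong (λ d → shear t (lookup v) x xor (not d ∧ shear t (lookup v) c))
            (δ-injective (Injection.injective (↔⇒↣ σ)) t i) ⟩
  shear t (shear t (lookup v) ∘ (σ ⟨$⟩ʳ_)) i ∎
  where
  open ≡-Reasoning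
  t = top n
  x = σ ⟨$⟩ʳ i
  c = σ ⟨$⟩ʳ t
  e = not (δ t x) ∧ not (δ c t)
  row = λ j → Qentry n σ i j ∧ lookup v j

lookup-⊕ : ∀ {n} (u v : V n) → lookup (u ⊕ v) ≗ λ i → lookup u i xor lookup v i
lookup-⊕ u v i = lookup-zipWith _xor_ i u v

module _ {n : ℕ} where

  Qapp-cong : ∀ {σ ρ : Sym n} → σ ≈ₚ ρ → ∀ v → Qapp n σ v ≡ Qapp n ρ v
  Qapp-cong {σ} {ρ} σ≈ρ v = Pointwise-≡⇒≡ (ext λ i → begin
    lookup (Qapp n σ v) i                        ≡⟨ lookup-Qapp n σ v i ⟩
    shear t (shear t (lookup v) ∘ (σ ⟨$⟩ʳ_)) i  ≡⟨ shear-cong t (cong (shear t (lookup v)) ∘ σ≈ρ) i ⟩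
    shear t (shear t (lookup v) ∘ (ρ ⟨$⟩ʳ_)) i  ≡⟨ lookup-Qapp n ρ v i ⟨
    lookup (Qapp n ρ v) i                        ∎)
    where open ≡-Reasoning; t = top n

  Qapp-⊕ : ∀ (σ : Sym n) u v → Qapp n σ (u ⊕ v) ≡ Qapp n σ u ⊕ Qapp n σ v
  Qapp-⊕ σ u v = Pointwise-≡⇒≡ (ext λ i → begin
    lookup (Qapp n σ (u ⊕ v)) i
      ≡⟨ lookup-Qapp n σ (u ⊕ v) i ⟩
    shear t (shear t (lookup (u ⊕ v)) ∘ σ′) i
      ≡⟨ shear-cong t (λ k → trans (shear-cong t (lookup-⊕ u v) (σ′ k))
                                   (shear-xor t (lookup u) (lookup v) (σ′ k))) i ⟩
    shear t (λ k → shear t (lookup u) (σ′ k) xor shear t (lookup v) (σ′ k)) i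
      ≡⟨ shear-xor t (shear t (lookup u) ∘ σ′) (shear t (lookup v) ∘ σ′) i ⟩
    shear t (shear t (lookup u) ∘ σ′) i xor shear t (shear t (lookup v) ∘ σ′) i
      ≡⟨ cong₂ _xor_ (lookup-Qapp n σ u i) (lookup-Qapp n σ v i) ⟨
    lookup (Qapp n σ u) i xor lookup (Qapp n σ v) i
      ≡⟨ lookup-⊕ (Qapp n σ u) (Qapp n σ v) i ⟨
    lookup (Qapp n σ u ⊕ Qapp n σ v) i ∎)
    where open ≡-Reasoning; t = top n; σ′ = σ ⟨$⟩ʳ_

  Qapp-zero : ∀ (σ : Sym n) → Qapp n σ (zeroV n) ≡ zeroV n
  Qapp-zero σ = Pointwise-≡⇒≡ (ext λ i → begin
    lookup (Qapp n σ (zeroV n)) i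
      ≡⟨ lookup-Qapp n σ (zeroV n) i ⟩
    shear t (shear t (lookup (zeroV n)) ∘ (σ ⟨$⟩ʳ_)) i
      ≡⟨ shear-cong t (λ k → trans (shear-cong t (λ j → lookup-replicate j false) (σ ⟨$⟩ʳ k))
                                   (shear-false t (σ ⟨$⟩ʳ k))) i ⟩
    shear t (λ _ → false) i
      ≡⟨ shear-false t i ⟩
    false
      ≡⟨ lookup-replicate i false ⟨
    lookup (zeroV n) i ∎)
    where open ≡-Reasoning; t = top n

  Qapp-· : ∀ (σ ρ : Sym n) v → Qapp n (σ · ρ) v ≡ Qapp n σ (Qapp n ρ v)
  Qapp-· σ ρ v = Pointwise-≡⇒≡ (ext λ i → begin
    lookup (Qapp n (σ · ρ) v) i
      ≡⟨ lookup-Qapp n (σ · ρ) v i ⟩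
    shear t (shear t (lookup v) ∘ ρ′ ∘ σ′) i
      ≡⟨ shear-cong t (λ k → shear-involutive t (shear t (lookup v) ∘ ρ′) (σ′ k)) i ⟨
    shear t (shear t (shear t (shear t (lookup v) ∘ ρ′)) ∘ σ′) i
      ≡⟨ shear-cong t (λ k → shear-cong t (lookup-Qapp n ρ v) (σ′ k)) i ⟨
    shear t (shear t (lookup (Qapp n ρ v)) ∘ σ′) i
      ≡⟨ lookup-Qapp n σ (Qapp n ρ v) i ⟨
    lookup (Qapp n σ (Qapp n ρ v)) i ∎)
    where open ≡-Reasoning; t = top n; σ′ = σ ⟨$⟩ʳ_; ρ′ = ρ ⟨$⟩ʳ_

  Qapp-id : ∀ v → Qapp n id v ≡ v
  Qapp-id v = Pointwise-≡⇒≡ (ext λ i →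
    trans (lookup-Qapp n id v i) (shear-involutive (top n) (lookup v) i))

-- _≈SD_ as a record type, so that unification can recover its indices.
record _≃_ {n} (x y : SD n) : Set where
  constructor _,_
  field
    vec  : proj₁ x ≡ proj₁ y
    perm : proj₂ x ≈ₚ proj₂ y

≃⇒≈SD : ∀ {n} {x y : SD n} → x ≃ y → x ≈SD y
≃⇒≈SD (p , q) = p , q

module _ {n : ℕ} where

  ≃-isEquivalence : IsEquivalence (_≃_ {n})
  ≃-isEquivalence = record
    { refl  = refl , λ _ → refl
    ; sym   = λ (p , q) → sym p , sym ∘ q
    ; trans = λ (p , q) (p′ , q′) → trans p p′ , λ i → trans (q i) (q′ i)
    }

  ∙SD-cong : Congruent₂ _≃_ (_∙SD_ {n})
  ∙SD-cong {b , σ} {_ , σ′} {c , ρ} {_ , ρ′} (refl , σ≈σ′) (refl , ρ≈ρ′) =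
    cong (b ⊕_) (Qapp-cong {σ = σ} {σ′} σ≈σ′ c) ,
    λ i → trans (cong (ρ ⟨$⟩ʳ_) (σ≈σ′ i)) (ρ≈ρ′ (σ′ ⟨$⟩ʳ i))

  ∙SD-assoc : Associative _≃_ (_∙SD_ {n})
  ∙SD-assoc (a , σ) (b , ρ) (c , τ) = vec , λ _ → refl
    where
    open ≡-Reasoning
    vec : (a ⊕ Qapp n σ b) ⊕ Qapp n (σ · ρ) c ≡ a ⊕ Qapp n σ (b ⊕ Qapp n ρ c)
    vec = begin
      (a ⊕ Qapp n σ b) ⊕ Qapp n (σ · ρ) c
        ≡⟨ zipWith-assoc xor-assoc a _ _ ⟩
      a ⊕ (Qapp n σ b ⊕ Qapp n (σ · ρ) c)
        ≡⟨ cong (λ w → a ⊕ (Qapp n σ b ⊕ w)) (Qapp-· σ ρ c) ⟩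
      a ⊕ (Qapp n σ b ⊕ Qapp n σ (Qapp n ρ c))
        ≡⟨ cong (a ⊕_) (Qapp-⊕ σ b (Qapp n ρ c)) ⟨
      a ⊕ Qapp n σ (b ⊕ Qapp n ρ c) ∎

  ∙SD-identityˡ : LeftIdentity _≃_ (zeroV n , id) _∙SD_
  ∙SD-identityˡ (b , σ) = trans (zipWith-identityˡ xor-identityˡ (Qapp n id b)) (Qapp-id b) , λ _ → refl

  ∙SD-identityʳ : RightIdentity _≃_ (zeroV n , id) _∙SD_
  ∙SD-identityʳ (b , σ) = trans (cong (b ⊕_) (Qapp-zero σ)) (zipWith-identityʳ xor-identityʳ b) , λ _ → refl

SD-monoid : ℕ → Monoid 0ℓ 0ℓ
SD-monoid n = record
  { Carrier  = SD n
  ; _≈_      = _≃_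
  ; _∙_      = _∙SD_
  ; ε        = zeroV n , id
  ; isMonoid = record
    { isSemigroup = record
      { isMagma = record { isEquivalence = ≃-isEquivalence ; ∙-cong = ∙SD-cong }
      ; assoc   = ∙SD-assoc
      }
    ; identity = ∙SD-identityˡ , ∙SD-identityʳ
    }
  }

module _ {c ℓ} (M : Monoid c ℓ) where

  open Monoid M using (Carrier; _≈_; _∙_; rawMonoid; setoid; identityʳ; ∙-congˡ; ∙-congʳ)
    renaming (refl to ≈-refl; sym to ≈-sym; trans to ≈-trans)
  open SetoidReasoning setoid

  module _ {a} {A : Set a} (f : A → Carrier) where

    foldMap-[_] : ∀ x → foldMap rawMonoid f (x ∷ []) ≈ f x
    foldMap-[ x ] = identityʳ (f x)

    foldMap-[_,_] : ∀ x y → foldMap rawMonoid f (x ∷ y ∷ []) ≈ f x ∙ f y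
    foldMap-[ x , y ] = ∙-congˡ (identityʳ (f y))

  foldMap-respects-~ : ∀ {n} (f : Letter n → Carrier) →
                       (∀ {u v} → Rel u v → foldMap rawMonoid f u ≈ foldMap rawMonoid f v) →
                       ∀ {u v} → u ~ v → foldMap rawMonoid f u ≈ foldMap rawMonoid f v
  foldMap-respects-~ f respects-Rel (step l u v r u-v) = begin
    h (l ++ u ++ r)   ≈⟨ ++-homo M f l ⟩
    h l ∙ h (u ++ r)  ≈⟨ ∙-congˡ (++-homo M f u) ⟩
    h l ∙ (h u ∙ h r) ≈⟨ ∙-congˡ (∙-congʳ (respects-Rel u-v)) ⟩
    h l ∙ (h v ∙ h r) ≈⟨ ∙-congˡ (++-homo M f v) ⟨
    h l ∙ h (v ++ r)  ≈⟨ ++-homo M f l ⟨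
    h (l ++ v ++ r)   ∎
    where h = foldMap rawMonoid f
  foldMap-respects-~ f respects-Rel ~refl        = ≈-refl
  foldMap-respects-~ f respects-Rel (~sym p)     = ≈-sym (foldMap-respects-~ f respects-Rel p)
  foldMap-respects-~ f respects-Rel (~trans p q) =
    ≈-trans (foldMap-respects-~ f respects-Rel p) (foldMap-respects-~ f respects-Rel q)

module _ {n : ℕ} where

  open Monoid (SD-monoid n) using (rawMonoid; ε; identityˡ; identityʳ; assoc; ∙-congˡ; ∙-congʳ; setoid)
    renaming (sym to ≃-sym; trans to ≃-trans)
  open SetoidReasoning setoid

  generator : Letter n → SD n
  generator (inj₁ s) = scal1 n s , id
  generator (inj₂ σ) = zeroV n , σ

  φ : Word n → SD n
  φ = foldMap rawMonoid generator

  translation-∙ : ∀ a b (σ : Sym n) → ((a , id) ∙SD (b , σ)) ≃ (a ⊕ b , σ)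
  translation-∙ a b σ = cong (a ⊕_) (Qapp-id b) , λ _ → refl

  translation-perm : ∀ a (σ : Sym n) → ((a , id) ∙SD (zeroV n , σ)) ≃ (a , σ)
  translation-perm a σ = ≃-trans (translation-∙ a (zeroV n) σ) (zipWith-identityʳ xor-identityʳ a , λ _ → refl)

  permutation-∙ : ∀ (π : Sym n) b σ → ((zeroV n , π) ∙SD (b , σ)) ≃ (Qapp n π b , π · σ)
  permutation-∙ π b σ = zipWith-identityˡ xor-identityˡ (Qapp n π b) , λ _ → refl

  φ-respects-Rel : ∀ {u v} → Rel u v → φ u ≃ φ v
  φ-respects-Rel (z2-mul s t) = begin
    φ (inj₁ s ∷ inj₁ t ∷ [])
      ≈⟨ foldMap-[_,_] (SD-monoid n) generator (inj₁ s) (inj₁ t) ⟩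
    (scal1 n s , id) ∙SD (scal1 n t , id)
      ≈⟨ translation-∙ (scal1 n s) (scal1 n t) id ⟩
    (scal1 n s ⊕ scal1 n t , id)
      ≡⟨ cong (_, id) (zipWith-replicate _xor_ s t) ⟩
    (scal1 n (s xor t) , id)
      ≈⟨ foldMap-[_] (SD-monoid n) generator (inj₁ (s xor t)) ⟨
    φ (inj₁ (s xor t) ∷ []) ∎
  φ-respects-Rel z2-unit = foldMap-[_] (SD-monoid n) generator (inj₁ false)
  φ-respects-Rel (sym-mul σ ρ τ τ≈σ·ρ) = begin
    φ (inj₂ σ ∷ inj₂ ρ ∷ [])
      ≈⟨ foldMap-[_,_] (SD-monoid n) generator (inj₂ σ) (inj₂ ρ) ⟩
    (zeroV n , σ) ∙SD (zeroV n , ρ)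
      ≈⟨ permutation-∙ σ (zeroV n) ρ ⟩
    (Qapp n σ (zeroV n) , σ · ρ)
      ≈⟨ Qapp-zero σ , (λ i → sym (τ≈σ·ρ i)) ⟩
    (zeroV n , τ)
      ≈⟨ foldMap-[_] (SD-monoid n) generator (inj₂ τ) ⟨
    φ (inj₂ τ ∷ []) ∎
  φ-respects-Rel (sym-unit τ τ≈id) =
    ≃-trans (foldMap-[_] (SD-monoid n) generator (inj₂ τ)) (refl , τ≈id)

  formulaFrom≃ : ∀ (π : Sym n) w → formulaFrom n π w ≃ ((zeroV n , π) ∙SD φ (embed w))
  formulaFrom≃ π []            = ≃-sym (identityʳ (zeroV n , π))
  formulaFrom≃ π ((s , σ) ∷ w) = begin
    formulaFrom n π ((s , σ) ∷ w)                  ≈⟨ translation-∙ a (proj₁ F) (proj₂ F) ⟨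
    (a , id) ∙SD F                                 ≈⟨ ∙-congˡ {a , id} (formulaFrom≃ (π · σ) w) ⟩
    (a , id) ∙SD ((zeroV n , π · σ) ∙SD X)         ≈⟨ assoc (a , id) (zeroV n , π · σ) X ⟨
    ((a , id) ∙SD (zeroV n , π · σ)) ∙SD X         ≈⟨ ∙-congʳ {X} prefix ⟩
    ((zeroV n , π) ∙SD (gs ∙SD gσ)) ∙SD X          ≈⟨ assoc (zeroV n , π) (gs ∙SD gσ) X ⟩
    (zeroV n , π) ∙SD ((gs ∙SD gσ) ∙SD X)          ≈⟨ ∙-congˡ {zeroV n , π} (assoc gs gσ X) ⟩
    (zeroV n , π) ∙SD φ (embed ((s , σ) ∷ w))      ∎
    where
    a  = Qapp n π (scal1 n s)
    F  = formulaFrom n (π · σ) w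
    X  = φ (embed w)
    gs = generator (inj₁ s)
    gσ = generator (inj₂ σ)
    prefix : ((a , id) ∙SD (zeroV n , π · σ)) ≃ ((zeroV n , π) ∙SD (gs ∙SD gσ))
    prefix = begin
      (a , id) ∙SD (zeroV n , π · σ)   ≈⟨ translation-perm a (π · σ) ⟩
      (a , π · σ)                      ≈⟨ permutation-∙ π (scal1 n s) σ ⟨
      (zeroV n , π) ∙SD (scal1 n s , σ) ≈⟨ ∙-congˡ {zeroV n , π} (translation-perm (scal1 n s) σ) ⟨
      (zeroV n , π) ∙SD (gs ∙SD gσ)    ∎

  φ-embed : ∀ w → φ (embed w) ≃ formula n w
  φ-embed w = ≃-sym (≃-trans (formulaFrom≃ id w) (identityˡ (φ (embed w))))

mainTheorem10 : (n : ℕ) → 1 ≤ n →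
    Σ (Word n → SD n) λ φ →
      ((u v : Word n) → u ~ v → φ u ≈SD φ v)
      × ((u v : Word n) → φ (u ++ v) ≈SD (φ u ∙SD φ v))
      × ((w : List (Bool × Sym n)) → φ (embed w) ≈SD formula n w)
mainTheorem10 n _ =
  φ ,
  (λ _ _ → ≃⇒≈SD ∘ foldMap-respects-~ (SD-monoid n) generator φ-respects-Rel) ,
  (λ u _ → ≃⇒≈SD (++-homo (SD-monoid n) generator u)) ,
  (λ w → ≃⇒≈SD (φ-embed w))
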